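{- If $T$ is an (unrooted) tree whose center is $\{u,v\}$ (two vertices) and $\chi_D(T)=2$, then $\chi_{D_\ell}(T)=2$.
   Context: A vertex $v$ is in the center of a tree $T$ if $v$ minimizes $\max_{w\in V(T)}\operatorname{dist}(w,v)$. A coloring is distinguishing if no nontrivial automorphism of $T$ preserves all vertex colors, and proper if adjacent vertices receive different colors. $\chi_D(T)$ is the minimum number of colors in a proper distinguishing coloring of $T$. $\chi_{D_\ell}(T)$ is the minimum integer $k$ such that for every list assignment $L=\{L(v)\}$ with $|L(v)|\ge k$ for all $v$ there is a proper distinguishing coloring $f$ with $f(v)\in L(v)$ for all $v$. -}

module Defs where

open import Level using (0ℓ)
open import Data.Nat using (ℕ; zero; suc; _≤_; _≥_)
open import Data.Fin using (Fin)
open import Data.List using (List; []; _∷_; length)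
open import Data.List.Membership.Propositional using (_∈_)
open import Data.List.Relation.Unary.Unique.Propositional using (Unique)
open import Data.Product using (Σ; ∃; _×_; _,_)
open import Data.Sum using (_⊎_)
open import Data.Empty using (⊥)
open import Function.Definitions using (Injective)
open import Function.Bundles using (_⇔_)
open import Relation.Nullary using (¬_)
open import Relation.Binary.PropositionalEquality using (_≡_; _≢_)

record Graph (n : ℕ) : Set₁ where
  field
    Adj    : Fin n → Fin n → Set
    sym    : ∀ {a b} → Adj a b → Adj b a
    irrefl : ∀ {a} → ¬ Adj a a
open Graph public

data Walk {n : ℕ} (G : Graph n) : Fin n → Fin n → ℕ → Set where
  here  : ∀ {a} → Walk G a a 0
  step  : ∀ {a b c k} → Adj G a b → Walk G b c k → Walk G a c (suc k)

Connected : ∀ {n} → Graph n → Set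
Connected G = ∀ a b → ∃ λ k → Walk G a b k

Chain : ∀ {n} → Graph n → Fin n → List (Fin n) → Fin n → Set
Chain G a []       z = a ≡ z
Chain G a (b ∷ bs) z = Adj G a b × Chain G b bs z

-- A cycle: distinct vertices v₀ v₁ … v_k (k ≥ 2) with v_i ~ v_{i+1} and v_k ~ v₀.
HasCycle : ∀ {n} → Graph n → Set
HasCycle {n} G = Σ (Fin n) λ v₀ → Σ (List (Fin n)) λ rest → Σ (Fin n) λ vₖ →
  2 ≤ length rest × Unique (v₀ ∷ rest) × Chain G v₀ rest vₖ × Adj G vₖ v₀

IsTree : ∀ {n} → Graph n → Set
IsTree G = Connected G × ¬ HasCycle G

EccAtMost : ∀ {n} → Graph n → Fin n → ℕ → Set
EccAtMost G v e = ∀ w → ∃ λ k → k ≤ e × Walk G w v k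

InCenter : ∀ {n} → Graph n → Fin n → Set
InCenter G v = ∀ x e → EccAtMost G x e → EccAtMost G v e

CenterIsPair : ∀ {n} → Graph n → Fin n → Fin n → Set
CenterIsPair G u v = u ≢ v × InCenter G u × InCenter G v ×
  (∀ x → InCenter G x → x ≡ u ⊎ x ≡ v)

-- Automorphisms (an injective self-map of the finite set Fin n is a bijection).
IsAutomorphism : ∀ {n} → Graph n → (Fin n → Fin n) → Set
IsAutomorphism G σ = Injective _≡_ _≡_ σ × (∀ a b → Adj G a b ⇔ Adj G (σ a) (σ b))

Proper : ∀ {n} {C : Set} → Graph n → (Fin n → C) → Set
Proper G c = ∀ a b → Adj G a b → c a ≢ c b

Distinguishing : ∀ {n} {C : Set} → Graph n → (Fin n → C) → Set
Distinguishing G c = ∀ σ → IsAutomorphism G σ → (∀ x → c (σ x) ≡ c x) → ∀ x → σ x ≡ x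

DColorable : ∀ {n} → Graph n → ℕ → Set
DColorable {n} G k = Σ (Fin n → Fin k) λ c → Proper G c × Distinguishing G c

ChiD≡ : ∀ {n} → Graph n → ℕ → Set
ChiD≡ G k = DColorable G k × (∀ j → j Data.Nat.< k → ¬ DColorable G j)

ListDColorable : ∀ {n} → Graph n → ℕ → Set
ListDColorable {n} G k = (L : Fin n → List ℕ) →
  (∀ v → Unique (L v) × k ≤ length (L v)) →
  Σ (Fin n → ℕ) λ f → (∀ v → f v ∈ L v) × Proper G f × Distinguishing G f

ChiDL≡ : ∀ {n} → Graph n → ℕ → Set
ChiDL≡ G k = ListDColorable G k × (∀ j → j Data.Nat.< k → ¬ ListDColorable G j)

-- Lower bound: a list-distinguishing colouring from the lists [0, …, k-1] is an
-- ordinary proper distinguishing colouring with k colours, so χ_{D_ℓ}(T) ≥ χ_D(T).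
--
-- Upper bound.  (1) Paths in a tree are unique; consequently every vertex on the
-- u–v path is reached from any w no later than u or v is, so it is central.
-- A central pair therefore consists of adjacent vertices.  (2) Automorphisms map
-- the center to itself.  An automorphism fixing u preserves every proper
-- 2-colouring c (colours alternate along walks to u).  Hence, for ANY proper
-- colouring f, an automorphism preserving f cannot swap the adjacent central
-- vertices, so it fixes u, preserves the distinguishing 2-colouring c and is the
-- identity: every proper colouring of T is distinguishing.  (3) A tree is
-- properly colourable from lists of two colours: root it at u and give each
-- vertex a colour of its list different from its parent's colour.
module Submission where

open import Defs hiding (sym)
open import Data.Nat using (ℕ; zero; suc; _≤_; _<_; z≤n; s≤s; _≟_)
open import Data.Nat.Properties using (≤-reflexive; <-irrefl)
open import Data.Fin using (Fin; zero; suc; toℕ; fromℕ<; punchOut)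
open import Data.Fin.Properties using (any?; punchOut-injective; injective⇒≤; toℕ-fromℕ<) renaming (_≟_ to _≟ᶠ_)
open import Data.List using (List; []; _∷_; length; _++_; upTo)
open import Data.List.Properties using (length-upTo)
open import Data.List.Membership.Propositional using (_∈_; _∉_)
open import Data.List.Membership.Propositional.Properties using (∈-++⁻; ∈-upTo⁻)
open import Data.List.Relation.Binary.Subset.Propositional using (_⊆_)
open import Data.List.Relation.Unary.Any using (here; there)
open import Data.List.Relation.Unary.All.Properties.Core using (¬Any⇒All¬; All¬⇒¬Any)
open import Data.List.Relation.Unary.Unique.Propositional using (Unique)
open import Data.List.Relation.Unary.Unique.Propositional.Properties using (upTo⁺)
open import Data.List.Relation.Unary.All using ([]; _∷_)
open import Data.List.Relation.Unary.AllPairs as AllPairs using ([]; _∷_)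
open import Data.Product using (Σ; ∃; _×_; _,_; proj₁; proj₂)
open import Data.Sum using (_⊎_; inj₁; inj₂)
open import Data.Empty using (⊥-elim)
open import Function.Definitions using (Injective)
open import Function.Bundles using (Equivalence)
open import Relation.Nullary using (¬_; yes; no)
open import Relation.Binary.Definitions using (DecidableEquality)
open import Relation.Binary.PropositionalEquality using (_≡_; _≢_; refl; sym; trans; cong; subst; module ≡-Reasoning)

head∉tail : ∀ {A : Set} {x : A} {xs} → Unique (x ∷ xs) → x ∉ xs
head∉tail u = All¬⇒¬Any (AllPairs.head u)

avoid : ∀ {A : Set} → DecidableEquality A → (l : List A) → Unique l → 2 ≤ length l →
  (c : A) → Σ A λ x → x ∈ l × x ≢ c
avoid _ [] _ () _
avoid _ (_ ∷ []) _ (s≤s ()) _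
avoid _≟_ (a ∷ b ∷ _) ((a≢b ∷ _) ∷ _) _ c with a ≟ c
... | no a≢c = a , here refl , a≢c
... | yes refl = b , there (here refl) , λ b≡a → a≢b (sym b≡a)

fin2-other : ∀ {x y z : Fin 2} → x ≢ z → y ≢ z → x ≡ y
fin2-other {zero}     {zero}     _   _   = refl
fin2-other {suc zero} {suc zero} _   _   = refl
fin2-other {zero}     {suc zero} {zero}     x≢z _   = ⊥-elim (x≢z refl)
fin2-other {zero}     {suc zero} {suc zero} _   y≢z = ⊥-elim (y≢z refl)
fin2-other {suc zero} {zero}     {zero}     _   y≢z = ⊥-elim (y≢z refl)
fin2-other {suc zero} {zero}     {suc zero} x≢z _   = ⊥-elim (x≢z refl)

-- An injective self-map of a finite set is surjective (pigeonhole): otherwise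
-- it would inject Fin (suc m) into Fin m.
injective⇒surjective : ∀ {n} (σ : Fin n → Fin n) → Injective _≡_ _≡_ σ →
  ∀ w → ∃ λ x → σ x ≡ w
injective⇒surjective {zero} σ _ ()
injective⇒surjective {suc m} σ σ-inj w with any? (λ x → σ x ≟ᶠ w)
... | yes hit = hit
... | no miss = ⊥-elim (<-irrefl refl (injective⇒≤ squeeze-injective))
  where
  squeeze : Fin (suc m) → Fin m
  squeeze x = punchOut {i = w} (λ w≡σx → miss (x , sym w≡σx))
  squeeze-injective : Injective _≡_ _≡_ squeeze
  squeeze-injective {x} {y} eq = σ-inj
    (punchOut-injective (λ e → miss (x , sym e)) (λ e → miss (y , sym e)) eq)

module Chains {n : ℕ} (T : Graph n) where
  open import Data.List.Membership.DecPropositional (_≟ᶠ_ {n}) using (_∈?_) public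

  IsPath : Fin n → List (Fin n) → Fin n → Set
  IsPath a xs z = Chain T a xs z × Unique (a ∷ xs)

  walk⇒chain : ∀ {a b k} → Walk T a b k →
    Σ (List (Fin n)) λ xs → Chain T a xs b × length xs ≡ k
  walk⇒chain here = [] , refl , refl
  walk⇒chain (step {b = b} ab w) with walk⇒chain w
  ... | xs , ch , refl = b ∷ xs , (ab , ch) , refl

  end∈ : ∀ {a xs z} → Chain T a xs z → z ∈ a ∷ xs
  end∈ {xs = []} refl = here refl
  end∈ {xs = _ ∷ _} (_ , ch) = there (end∈ ch)

  _++ᶜ_ : ∀ {a xs m ys z} → Chain T a xs m → Chain T m ys z → Chain T a (xs ++ ys) z
  _++ᶜ_ {xs = []} refl ch = ch
  _++ᶜ_ {xs = _ ∷ _} (ax , ch₁) ch₂ = ax , ch₁ ++ᶜ ch₂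

  reverseᶜ : ∀ {a xs z} → Chain T a xs z →
    Σ (List (Fin n)) λ ys → Chain T z ys a × ys ⊆ a ∷ xs
  reverseᶜ {xs = []} refl = [] , refl , λ ()
  reverseᶜ {a} {xs = x ∷ xs} (ax , ch) with reverseᶜ ch
  ... | ys , zYSx , ys⊆ = ys ++ (a ∷ []) , zYSx ++ᶜ (Graph.sym T ax , refl) , sub
    where
    sub : ys ++ (a ∷ []) ⊆ a ∷ x ∷ xs
    sub p with ∈-++⁻ ys p
    ... | inj₁ q = there (ys⊆ q)
    ... | inj₂ (here refl) = here refl

  suffix : ∀ {y a xs z} → y ∈ a ∷ xs → Chain T a xs z → Unique (a ∷ xs) →
    Σ (List (Fin n)) λ s → IsPath y s z × s ⊆ xs
  suffix {xs = xs} (here refl) ch u = xs , (ch , u) , λ p → p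
  suffix {xs = _ ∷ _} (there p) (_ , ch) (_ ∷ u) with suffix p ch u
  ... | s , path , s⊆ = s , path , λ q → there (s⊆ q)

  -- Every chain can be shortened to a path on a subset of its vertices:
  -- when the start reappears later, jump to its last occurrence.
  shortcut : ∀ {a xs z} → Chain T a xs z → Σ (List (Fin n)) λ ys → IsPath a ys z × ys ⊆ xs
  shortcut {xs = []} refl = [] , (refl , [] ∷ []) , λ ()
  shortcut {a} {xs = b ∷ xs} (ab , ch) with shortcut ch
  ... | ys , (bYSz , u) , ys⊆ with a ∈? (b ∷ ys)
  ...   | no a∉ = b ∷ ys , ((ab , bYSz) , ¬Any⇒All¬ _ a∉ ∷ u) ,
                  λ { (here refl) → here refl ; (there q) → there (ys⊆ q) }
  ...   | yes a∈ with suffix a∈ bYSz u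
  ...     | s , path , s⊆ = s , path , λ q → there (ys⊆ (s⊆ q))

  reachOnChain : ∀ {a xs z y e} → Chain T a xs z → length xs ≤ e → y ∈ a ∷ xs →
    ∃ λ k → k ≤ e × Walk T a y k
  reachOnChain _ _ (here refl) = 0 , z≤n , here
  reachOnChain {xs = _ ∷ _} (ax , ch) (s≤s l) (there p) with reachOnChain ch l p
  ... | k , k≤e , w = suc k , s≤s k≤e , step ax w

  pathBetween : Connected T → ∀ a b → Σ (List (Fin n)) λ xs → IsPath a xs b
  pathBetween conn a b with conn a b
  ... | _ , w with walk⇒chain w
  ...   | xs , ch , _ with shortcut ch
  ...     | ys , path , _ = ys , path

  fork⇒cycle : ∀ {a x y zs} → Adj T a x → Adj T a y → x ≢ y → IsPath x zs y →
    a ∉ x ∷ zs → HasCycle T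
  fork⇒cycle {zs = []} _ _ x≢y (x≡y , _) _ = ⊥-elim (x≢y x≡y)
  fork⇒cycle {a} {x} {y} {z ∷ zs} ax ay _ (xZSy , u) a∉ =
    a , x ∷ z ∷ zs , y , s≤s (s≤s z≤n) , ¬Any⇒All¬ _ a∉ ∷ u ,
    (ax , xZSy) , Graph.sym T ay

  -- In an acyclic graph two paths with the same ends coincide: if they first
  -- leave the common start a through different neighbours, the rest of the
  -- two paths together form a cycle through a.
  pathsUnique : ¬ HasCycle T → ∀ {a xs ys z} → IsPath a xs z → IsPath a ys z → xs ≡ ys
  pathsUnique nc {xs = []} {[]} _ _ = refl
  pathsUnique nc {xs = []} {_ ∷ _} (refl , _) ((_ , ch) , u) = ⊥-elim (head∉tail u (end∈ ch))
  pathsUnique nc {xs = _ ∷ _} {[]} ((_ , ch) , u) (refl , _) = ⊥-elim (head∉tail u (end∈ ch))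
  pathsUnique nc {a} {x ∷ xs} {y ∷ ys} ((ax , xXSz) , ux) ((ay , yYSz) , uy) with x ≟ᶠ y
  ... | yes refl = cong (x ∷_) (pathsUnique nc (xXSz , AllPairs.tail ux) (yYSz , AllPairs.tail uy))
  ... | no x≢y with reverseᶜ yYSz
  ...   | ys' , zYSy , ys'⊆ with shortcut (xXSz ++ᶜ zYSy)
  ...     | zs , xZSy , zs⊆ = ⊥-elim (nc (fork⇒cycle ax ay x≢y xZSy a∉))
    where
    a∉ : a ∉ x ∷ zs
    a∉ (here a≡x) = head∉tail ux (here a≡x)
    a∉ (there p) with ∈-++⁻ xs (zs⊆ p)
    ... | inj₁ q = head∉tail ux (there q)
    ... | inj₂ q = head∉tail uy (ys'⊆ q)

module Center {n : ℕ} (T : Graph n) where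
  open Chains T

  -- If p lies on the u–v path, then p lies on any chain from a vertex w to u
  -- or on any chain from w to v; otherwise these chains would produce a second
  -- u–v path avoiding p.
  onPath⇒onChainToEnd : ¬ HasCycle T → ∀ {u R v p} → IsPath u R v → p ∈ u ∷ R →
    ∀ {w P Q} → Chain T w P u → Chain T w Q v → p ∈ w ∷ P ⊎ p ∈ w ∷ Q
  onPath⇒onChainToEnd nc {u} {R} {v} {p} uRv p∈ {w} {P} {Q} wPu wQv
    with reverseᶜ wPu
  ... | P' , uP'w , P'⊆ with shortcut (uP'w ++ᶜ wQv)
  ...   | Z , uZv , Z⊆ = side (subst (λ l → p ∈ u ∷ l) (pathsUnique nc uRv uZv) p∈)
    where
    side : p ∈ u ∷ Z → p ∈ w ∷ P ⊎ p ∈ w ∷ Q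
    side (here refl) = inj₁ (end∈ wPu)
    side (there p∈Z) with ∈-++⁻ P' (Z⊆ p∈Z)
    ... | inj₁ q = inj₁ (P'⊆ q)
    ... | inj₂ q = inj₂ (there q)

  eccOnPath : ¬ HasCycle T → ∀ {u R v p} → IsPath u R v → p ∈ u ∷ R →
    ∀ e → EccAtMost T u e → EccAtMost T v e → EccAtMost T p e
  eccOnPath nc uRv p∈ e eccU eccV w with eccU w | eccV w
  ... | _ , k≤e , wu | _ , l≤e , wv with walk⇒chain wu | walk⇒chain wv
  ...   | P , wPu , refl | Q , wQv , refl with onPath⇒onChainToEnd nc uRv p∈ wPu wQv
  ...     | inj₁ p∈P = reachOnChain wPu k≤e p∈P
  ...     | inj₂ p∈Q = reachOnChain wQv l≤e p∈Q

  betweenCentral : ¬ HasCycle T → ∀ {u R v p} → InCenter T u → InCenter T v →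
    IsPath u R v → p ∈ u ∷ R → InCenter T p
  betweenCentral nc cu cv uRv p∈ x e eccX = eccOnPath nc uRv p∈ e (cu x e eccX) (cv x e eccX)

  -- The two vertices of a two-element center are adjacent: an inner vertex of
  -- the u–v path would be a third central vertex.
  centralPairAdjacent : IsTree T → ∀ {u v} → CenterIsPair T u v → Adj T u v
  centralPairAdjacent (conn , nc) {u} {v} (u≢v , cu , cv , onlyCentral)
    with pathBetween conn u v
  ... | [] , (u≡v , _) = ⊥-elim (u≢v u≡v)
  ... | _ ∷ [] , ((ux , refl) , _) = ux
  ... | p ∷ q ∷ R , uRv@((_ , _ , qRv) , uniq)
    with onlyCentral p (betweenCentral nc cu cv uRv (there (here refl)))
  ...   | inj₁ refl = ⊥-elim (head∉tail uniq (here refl))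
  ...   | inj₂ refl = ⊥-elim (head∉tail (AllPairs.tail uniq) (end∈ qRv))

module Automorphisms {n : ℕ} (T : Graph n) where

  mapWalk : ∀ {σ} → IsAutomorphism T σ → ∀ {a b k} → Walk T a b k → Walk T (σ a) (σ b) k
  mapWalk aut here = here
  mapWalk aut (step {a} {b} ab w) = step (Equivalence.to (proj₂ aut a b) ab) (mapWalk aut w)

  -- Automorphisms preserve distances, hence map central vertices to central ones.
  centerInvariant : ∀ {σ} → IsAutomorphism T σ → ∀ {u} → InCenter T u → InCenter T (σ u)
  centerInvariant {σ} aut cu x e eccX w with injective⇒surjective σ (proj₁ aut) w
  ... | w' , refl with cu x e eccX w'
  ...   | k , k≤e , w'u = k , k≤e , mapWalk aut w'u

  -- An automorphism fixing r preserves every proper 2-colouring c, by induction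
  -- along a walk from y to r: both c y and c (σ y) differ from the colour of
  -- the next vertex.
  fixesRoot⇒preservesColouring : (c : Fin n → Fin 2) → Proper T c →
    ∀ {σ r} → IsAutomorphism T σ → σ r ≡ r → ∀ {y k} → Walk T y r k → c (σ y) ≡ c y
  fixesRoot⇒preservesColouring c c-proper aut σr≡r here = cong c σr≡r
  fixesRoot⇒preservesColouring c c-proper {σ} aut σr≡r (step {y} {b} yb w) =
    fin2-other
      (subst (c (σ y) ≢_) (fixesRoot⇒preservesColouring c c-proper aut σr≡r w)
        (c-proper (σ y) (σ b) (Equivalence.to (proj₂ aut y b) yb)))
      (c-proper y b yb)

properIsDistinguishing : ∀ {n} {T : Graph n} {u v} → IsTree T → CenterIsPair T u v →
  DColorable T 2 → ∀ {C : Set} (f : Fin n → C) → Proper T f → Distinguishing T f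
properIsDistinguishing {T = T} {u} {v} tree@(conn , _) centre@(_ , cu , _ , onlyCentral)
  (c , c-proper , c-distinguishing) f f-proper σ aut f∘σ≡f
  with onlyCentral (σ u) (Automorphisms.centerInvariant T aut cu)
... | inj₂ σu≡v = ⊥-elim (f-proper u v (Center.centralPairAdjacent T tree centre)
                            (trans (sym (f∘σ≡f u)) (cong f σu≡v)))
... | inj₁ σu≡u = c-distinguishing σ aut λ y →
  Automorphisms.fixesRoot⇒preservesColouring T c c-proper aut σu≡u (proj₂ (conn y u))

-- Greedy colouring of a tree rooted at r: the colour of a vertex is chosen
-- as a function of the colour of its parent (the next vertex towards r).
module Rooted {n : ℕ} (T : Graph n) (nc : ¬ HasCycle T) (conn : Connected T) (r : Fin n) where
  open Chains T

  rootPath : Fin n → List (Fin n)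
  rootPath x = proj₁ (pathBetween conn x r)

  rootPath-isPath : ∀ x → IsPath x (rootPath x) r
  rootPath-isPath x = proj₂ (pathBetween conn x r)

  -- If a lies on the root path of b, then b does not lie on the root path of
  -- a, which is the tail of b's root path starting at a.
  ancestor⇒notDescendant : ∀ {a b} → a ∈ rootPath b → b ∉ rootPath a
  ancestor⇒notDescendant {a} {b} a∈ b∈ with rootPath-isPath b
  ... | bPr , ub with suffix (there a∈) bPr ub
  ...   | s , aSr , s⊆ = head∉tail ub (s⊆ (subst (b ∈_) (pathsUnique nc (rootPath-isPath a) aSr) b∈))

  parentOf : ∀ {a b} → Adj T a b → a ∉ rootPath b → rootPath a ≡ b ∷ rootPath b
  parentOf {a} {b} ab a∉ with rootPath-isPath b
  ... | bPr , ub = pathsUnique nc (rootPath-isPath a) ((ab , bPr) , ¬Any⇒All¬ _ a∉b∷ ∷ ub)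
    where
    a∉b∷ : a ∉ b ∷ rootPath b
    a∉b∷ (here refl) = Graph.irrefl T ab
    a∉b∷ (there p) = a∉ p

  parentOrChild : ∀ {a b} → Adj T a b → rootPath a ≡ b ∷ rootPath b ⊎ rootPath b ≡ a ∷ rootPath a
  parentOrChild {a} {b} ab with a ∈? rootPath b
  ... | no a∉ = inj₁ (parentOf ab a∉)
  ... | yes a∈ = inj₂ (parentOf (Graph.sym T ab) (ancestor⇒notDescendant a∈))

  module Greedy {C : Set} (choose : Fin n → C → C) (c₀ : C) where

    -- The colour of x when its path to the root continues with the given list.
    colourAlong : Fin n → List (Fin n) → C
    colourAlong x [] = choose x c₀
    colourAlong x (y ∷ ys) = choose x (colourAlong y ys)

    greedy : Fin n → C
    greedy x = colourAlong x (rootPath x)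

    greedy-chosen : ∀ x → ∃ λ c → greedy x ≡ choose x c
    greedy-chosen x with rootPath x
    ... | [] = c₀ , refl
    ... | y ∷ ys = colourAlong y ys , refl

    greedy-proper : (∀ x c → choose x c ≢ c) → Proper T greedy
    greedy-proper avoids a b ab with parentOrChild ab
    ... | inj₁ eq = subst (_≢ greedy b) (sym (cong (colourAlong a) eq)) (avoids a (greedy b))
    ... | inj₂ eq = λ fa≡fb → avoids b (greedy a)
                      (trans (cong (colourAlong b) (sym eq)) (sym fa≡fb))

listColourTree : ∀ {n} {T : Graph n} → IsTree T → Fin n → (L : Fin n → List ℕ) →
  (∀ x → Unique (L x) × 2 ≤ length (L x)) →
  Σ (Fin n → ℕ) λ f → (∀ x → f x ∈ L x) × Proper T f
listColourTree {n} {T} (conn , nc) r L sizes = greedy , greedy∈L , greedy-proper avoids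
  where
  pickFor : (x : Fin n) → (c : ℕ) → Σ ℕ λ y → y ∈ L x × y ≢ c
  pickFor x = avoid _≟_ (L x) (proj₁ (sizes x)) (proj₂ (sizes x))
  open Rooted.Greedy T nc conn r (λ x c → proj₁ (pickFor x c)) 0
  avoids : ∀ x c → proj₁ (pickFor x c) ≢ c
  avoids x c = proj₂ (proj₂ (pickFor x c))
  greedy∈L : ∀ x → greedy x ∈ L x
  greedy∈L x with greedy-chosen x
  ... | c , eq = subst (_∈ L x) (sym eq) (proj₁ (proj₂ (pickFor x c)))

listDColourable⇒DColourable : ∀ {n} {T : Graph n} {k} → ListDColorable T k → DColorable T k
listDColourable⇒DColourable {n} {T} {k} LD
  with LD (λ _ → upTo k) (λ _ → upTo⁺ k , ≤-reflexive (sym (length-upTo k)))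
... | f , f∈ , f-proper , f-distinguishing = c , c-proper , c-distinguishing
  where
  c : Fin n → Fin k
  c x = fromℕ< (∈-upTo⁻ (f∈ x))
  same-colour : ∀ {a b} → c a ≡ c b → f a ≡ f b
  same-colour {a} {b} eq = begin
    f a           ≡⟨ sym (toℕ-fromℕ< (∈-upTo⁻ (f∈ a))) ⟩
    toℕ (c a)     ≡⟨ cong toℕ eq ⟩
    toℕ (c b)     ≡⟨ toℕ-fromℕ< (∈-upTo⁻ (f∈ b)) ⟩
    f b           ∎
    where open ≡-Reasoning
  c-proper : Proper T c
  c-proper a b ab eq = f-proper a b ab (same-colour eq)
  c-distinguishing : Distinguishing T c
  c-distinguishing σ aut preserves = f-distinguishing σ aut λ x → same-colour (preserves x)

lemma11 : (n : ℕ) (T : Graph n) (u v : Fin n) →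
    IsTree T → CenterIsPair T u v → ChiD≡ T 2 → ChiDL≡ T 2
lemma11 n T u v tree centre (twoColouring , minimal) = upper , lower
  where
  upper : ListDColorable T 2
  upper L sizes with listColourTree tree u L sizes
  ... | f , f∈L , f-proper =
    f , f∈L , f-proper , properIsDistinguishing tree centre twoColouring f f-proper

  lower : ∀ j → j < 2 → ¬ ListDColorable T j
  lower j j<2 LD = minimal j j<2 (listDColourable⇒DColourable {T = T} LD)
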